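{- For every $\delta>0$ and $n\in\mathbb{N}$ there exists $N\in\mathbb{N}$ such that the following holds for every $N$-partitioned hypergraph $H$ and every choice of vertices $\gamma_{ik}\in V_{ik}$, $i<k$, $i,k\in[N]$, such that the degree of $\gamma_{ik}$ in every $(i,j,k)$-triad, $i<j<k$, $j\in[N]$, is at least $\delta$. There exist an induced $n$-partitioned subhypergraph of $H$ with index set $I\subseteq[N]$ and vertices $\alpha_{ij},\beta_{ij}\in V_{ij}$, $i<j$, $i,j\in I$, such that $\{\alpha_{ij},\beta_{jk},\gamma_{ik}\}$ is an edge in the $(i,j,k)$-triad for all $i<j<k$, $i,j,k\in I$.
   Context: An $N$-partitioned hypergraph $H$ is a $3$-uniform hypergraph whose vertex set is partitioned into nonempty finite sets $V_{ij}$, $1\le i<j\le N$, such that every edge has one vertex in each of $V_{ij},V_{ik},V_{jk}$ for some $1\le i<j<k\le N$. For $i<j<k$, the $(i,j,k)$-triad is the set of edges with one vertex in each of $V_{ij},V_{ik},V_{jk}$. The degree of a vertex $v\in V_{ik}$ in the $(i,j,k)$-triad is the number of edges of that triad containing $v$ divided by $|V_{ij}|\cdot|V_{jk}|$. For $I\subseteq[N]$, the subhypergraph induced by $I$ is the $|I|$-partitioned hypergraph with parts $V_{ij}$, $i<j$, $i,j\in I$ (keeping original indices) and all edges of $H$ contained in the union of these parts; $I$ is its index set.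
   Formalization: The parameter δ ranges over the positive rationals. -}

module Defs where

open import Data.Nat using (ℕ; zero; suc; _+_; _*_)
open import Data.Bool using (Bool; true; false; if_then_else_)
open import Data.Fin using (Fin)
import Data.Fin as F
open import Data.Integer using (+_)
open import Data.Rational using (ℚ; _/_)

sumFin : (m : ℕ) → (Fin m → ℕ) → ℕ
sumFin zero    f = 0
sumFin (suc m) f = f F.zero + sumFin m (λ x → f (F.suc x))

countFin : (m : ℕ) → (Fin m → Bool) → ℕ
countFin m p = sumFin m (λ x → if p x then 1 else 0)

-- The part V_ij (used only for i < j) is Fin (suc (size i j)): finite and nonempty.
-- For i < j < k the (i,j,k)-triad is the set of triples (a , c , b) ∈ V_ij × V_ik × V_jk
-- with edge i j k a c b ≡ true (values of edge/size for other index triples are ignored).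
record PartHyp (N : ℕ) : Set where
  field
    size : Fin N → Fin N → ℕ
    edge : (i j k : Fin N) →
           Fin (suc (size i j)) → Fin (suc (size i k)) → Fin (suc (size j k)) → Bool

  V : Fin N → Fin N → Set
  V i j = Fin (suc (size i j))

  edgeCount : (i j k : Fin N) → V i k → ℕ
  edgeCount i j k v =
    sumFin (suc (size i j)) (λ a → countFin (suc (size j k)) (λ b → edge i j k a v b))

  degree : (i j k : Fin N) → V i k → ℚ
  degree i j k v = + edgeCount i j k v / (suc (size i j) * suc (size j k))

-- Let q be the denominator of δ, so that every γ_ik lies in at least |V_ij||V_jk|/q
-- edges of the (i,j,k)-triad. A first greedy pass picks indices from the top down and,
-- for each new j and each earlier k, a vertex β_jk ∈ V_jk; by a reverse Markov inequality
-- and averaging, some β_jk is "popular" (at least |V_ij|/2q vertices a ∈ V_ij make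
-- {a, γ_ik, β_jk} an edge) for a 1/2q fraction of the remaining candidates i < j, and
-- only those candidates are kept. A second greedy pass over the chosen indices, from the
-- bottom up, averages once more to pick α_ij among these popular partners so that
-- {α_ij, γ_ik, β_jk} is an edge for a 1/2q fraction of the remaining k > j. Each pass
-- loses a factor 2q per earlier point, so finitely many indices suffice.

module Submission where

open import Defs

module TriadTransversals where

  open import Algebra.Properties.CommutativeSemigroup using (interchange)
  open import Data.Bool using (Bool; true; false; T; if_then_else_)
  open import Data.Bool.Properties using (T-≡)
  open import Data.Fin as F using (Fin; _<_; opposite)
  import Data.Fin.Properties as Fin
  open import Data.List using (List; []; _∷_; length; filterᵇ)
  open import Data.List.Properties using (length-tabulate)
  open import Data.List.Relation.Binary.Sublist.Propositional using (_⊆_; []; _∷_; _∷ʳ_; ⊆-refl; ⊆-trans)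
  open import Data.List.Relation.Binary.Sublist.Propositional.Properties using (All-resp-⊆; filter-⊆)
  open import Data.List.Relation.Unary.All as All using (All; []; _∷_)
  open import Data.List.Relation.Unary.All.Properties using (all-filter; filter⁺)
  open import Data.List.Relation.Unary.AllPairs using (AllPairs; []; _∷_)
  open import Data.List.Relation.Unary.AllPairs.Properties using (tabulate⁺-<)
  open import Data.Nat as ℕ using (ℕ; zero; suc; _+_; _*_; _^_; _≤_; _≤ᵇ_; _≤?_; z≤n; s≤s; NonZero)
  open import Data.Nat.Properties
  open import Data.Product using (Σ; ∃-syntax; _,_; _×_; map₂)
  open import Function using (_∘_; id; Equivalence)
  open import Relation.Binary.PropositionalEquality
  open import Relation.Nullary using (yes; no; contradiction)
  open import Relation.Nullary.Decidable using (T?)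
  open ≤-Reasoning

  +-interchange : ∀ a b c d → a + b + (c + d) ≡ a + c + (b + d)
  +-interchange = interchange +-commutativeSemigroup

  indicator : Bool → ℕ
  indicator b = if b then 1 else 0

  sumFin-mono-≤ : ∀ m {f g : Fin m → ℕ} → (∀ b → f b ≤ g b) → sumFin m f ≤ sumFin m g
  sumFin-mono-≤ zero    f≤g = ≤-refl
  sumFin-mono-≤ (suc m) f≤g = +-mono-≤ (f≤g F.zero) (sumFin-mono-≤ m (f≤g ∘ F.suc))

  sumFin-mono-< : ∀ m {f g : Fin (suc m) → ℕ} → (∀ b → f b ℕ.< g b) →
                  sumFin (suc m) f ℕ.< sumFin (suc m) g
  sumFin-mono-< m f<g = +-mono-<-≤ (f<g F.zero) (sumFin-mono-≤ m (<⇒≤ ∘ f<g ∘ F.suc))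

  sumFin-const : ∀ m c → sumFin m (λ _ → c) ≡ m * c
  sumFin-const zero    c = refl
  sumFin-const (suc m) c = cong (c +_) (sumFin-const m c)

  sumFin-distrib-+ : ∀ m (f g : Fin m → ℕ) →
                     sumFin m (λ b → f b + g b) ≡ sumFin m f + sumFin m g
  sumFin-distrib-+ zero    f g = refl
  sumFin-distrib-+ (suc m) f g = begin-equality
    f F.zero + g F.zero + sumFin m (λ b → f (F.suc b) + g (F.suc b))
      ≡⟨ cong (f F.zero + g F.zero +_) (sumFin-distrib-+ m (f ∘ F.suc) (g ∘ F.suc)) ⟩
    f F.zero + g F.zero + (sumFin m (f ∘ F.suc) + sumFin m (g ∘ F.suc))
      ≡⟨ +-interchange (f F.zero) (g F.zero) _ _ ⟩
    f F.zero + sumFin m (f ∘ F.suc) + (g F.zero + sumFin m (g ∘ F.suc)) ∎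

  *-distribˡ-sumFin : ∀ m c (f : Fin m → ℕ) → c * sumFin m f ≡ sumFin m (λ b → c * f b)
  *-distribˡ-sumFin zero    c f = *-zeroʳ c
  *-distribˡ-sumFin (suc m) c f =
    trans (*-distribˡ-+ c (f F.zero) _) (cong (c * f F.zero +_) (*-distribˡ-sumFin m c (f ∘ F.suc)))

  sumFin-comm : ∀ m n (h : Fin m → Fin n → ℕ) →
                sumFin m (λ a → sumFin n (h a)) ≡ sumFin n (λ b → sumFin m (λ a → h a b))
  sumFin-comm zero    n h = trans (sym (*-zeroʳ n)) (sym (sumFin-const n 0))
  sumFin-comm (suc m) n h = begin-equality
    sumFin n (h F.zero) + sumFin m (λ a → sumFin n (h (F.suc a)))
      ≡⟨ cong (sumFin n (h F.zero) +_) (sumFin-comm m n (h ∘ F.suc)) ⟩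
    sumFin n (h F.zero) + sumFin n (λ b → sumFin m (λ a → h (F.suc a) b))
      ≡⟨ sym (sumFin-distrib-+ n (h F.zero) _) ⟩
    sumFin n (λ b → h F.zero b + sumFin m (λ a → h (F.suc a) b)) ∎

  countFin-≤ : ∀ m (p : Fin m → Bool) → countFin m p ≤ m
  countFin-≤ m p = begin
    countFin m p            ≤⟨ sumFin-mono-≤ m (λ b → indicator≤1 (p b)) ⟩
    sumFin m (λ _ → 1)      ≡⟨ sumFin-const m 1 ⟩
    m * 1                   ≡⟨ *-identityʳ m ⟩
    m                       ∎
    where
    indicator≤1 : ∀ x → indicator x ≤ 1
    indicator≤1 true  = ≤-refl
    indicator≤1 false = z≤n

  sumFin-pigeonhole : ∀ s M (g : Fin (suc s) → ℕ) → M * suc s ≤ sumFin (suc s) g → ∃[ b ] M ≤ g b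
  sumFin-pigeonhole s M g M·S≤Σg with Fin.any? (λ b → M ≤? g b)
  ... | yes large = large
  ... | no ¬large = contradiction M·S≤Σg (<⇒≱ (begin-strict
    sumFin (suc s) g          <⟨ sumFin-mono-< s (λ b → ≰⇒> (¬large ∘ (b ,_))) ⟩
    sumFin (suc s) (λ _ → M)  ≡⟨ sumFin-const (suc s) M ⟩
    suc s * M                 ≡⟨ *-comm (suc s) M ⟩
    M * suc s                 ∎))

  reverse-Markov : ∀ q s w (f : Fin (suc s) → ℕ) → (∀ b → f b ≤ suc w) →
                   suc w * suc s ≤ q * sumFin (suc s) f →
                   suc s ≤ 2 * q * countFin (suc s) (λ b → suc w ≤ᵇ 2 * q * f b)
  reverse-Markov q s w f f≤W W·S≤q·Σf = *-cancelˡ-≤ W (+-cancelˡ-≤ (W * S) _ _ (begin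
    W * S + W * S                                  ≡⟨ cong (W * S +_) (sym (+-identityʳ (W * S))) ⟩
    2 * (W * S)                                    ≤⟨ *-monoʳ-≤ 2 W·S≤q·Σf ⟩
    2 * (q * sumFin S f)                           ≡⟨ sym (*-assoc 2 q _) ⟩
    r * sumFin S f                                 ≡⟨ *-distribˡ-sumFin S r f ⟩
    sumFin S (λ b → r * f b)                       ≤⟨ sumFin-mono-≤ S pointwise ⟩
    sumFin S (λ b → W + r * W * indicator (large b))
      ≡⟨ sumFin-distrib-+ S (λ _ → W) (λ b → r * W * indicator (large b)) ⟩
    sumFin S (λ _ → W) + sumFin S (λ b → r * W * indicator (large b))
      ≡⟨ cong₂ _+_ (sumFin-const S W) (sym (*-distribˡ-sumFin S (r * W) (indicator ∘ large))) ⟩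
    S * W + r * W * count
      ≡⟨ cong₂ _+_ (*-comm S W) (trans (cong (_* count) (*-comm r W)) (*-assoc W r count)) ⟩
    W * S + W * (r * count)                        ∎))
    where
    W = suc w
    S = suc s
    r = 2 * q
    large : Fin S → Bool
    large b = W ≤ᵇ r * f b
    count = countFin S large
    pointwise : ∀ b → r * f b ≤ W + r * W * indicator (large b)
    pointwise b with large b in eq
    ... | true  = ≤-trans (*-monoʳ-≤ r (f≤W b)) (≤-trans (≤-reflexive (sym (*-identityʳ (r * W)))) (m≤n+m _ W))
    ... | false = ≤-trans (<⇒≤ (≰⇒> (λ W≤r·f → subst T eq (≤⇒≤ᵇ W≤r·f)))) (m≤m+n W _)

  length-filterᵇ-∷ : ∀ {X : Set} (p : X → Bool) x xs →
                     length (filterᵇ p (x ∷ xs)) ≡ indicator (p x) + length (filterᵇ p xs)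
  length-filterᵇ-∷ p x xs with p x
  ... | true  = refl
  ... | false = refl

  double-counting : ∀ {X : Set} q s (E : X → Fin (suc s) → Bool) (P : List X) →
                    All (λ x → suc s ≤ q * countFin (suc s) (E x)) P →
                    length P * suc s ≤ sumFin (suc s) (λ b → q * length (filterᵇ (λ x → E x b) P))
  double-counting q s E []      []           = z≤n
  double-counting q s E (x ∷ P) (row ∷ rows) = begin
    S + length P * S
      ≤⟨ +-mono-≤ {x = S} row (double-counting q s E P rows) ⟩
    q * countFin S (E x) + sumFin S (λ b → q * column P b)
      ≡⟨ cong (_+ sumFin S (λ b → q * column P b)) (*-distribˡ-sumFin S q (indicator ∘ E x)) ⟩
    sumFin S (λ b → q * indicator (E x b)) + sumFin S (λ b → q * column P b)
      ≡⟨ sym (sumFin-distrib-+ S (λ b → q * indicator (E x b)) (λ b → q * column P b)) ⟩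
    sumFin S (λ b → q * indicator (E x b) + q * column P b)
      ≤⟨ sumFin-mono-≤ S (λ b → ≤-reflexive (column-∷ b)) ⟩
    sumFin S (λ b → q * column (x ∷ P) b) ∎
    where
    S = suc s
    column : List _ → Fin S → ℕ
    column xs b = length (filterᵇ (λ y → E y b) xs)
    column-∷ : ∀ b → q * indicator (E x b) + q * column P b ≡ q * column (x ∷ P) b
    column-∷ b = trans (sym (*-distribˡ-+ q (indicator (E x b)) (column P b)))
                       (cong (q *_) (sym (length-filterᵇ-∷ (λ y → E y b) x P)))

  dense-column : ∀ {X : Set} q s (E : X → Fin (suc s) → Bool) (P : List X) →
              All (λ x → suc s ≤ q * countFin (suc s) (E x)) P →
              ∃[ b ] length P ≤ q * length (filterᵇ (λ x → E x b) P)
  dense-column q s E P rows = sumFin-pigeonhole s (length P) _ (double-counting q s E P rows)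

  AllPairs-resp-⊆ : ∀ {A : Set} {R : A → A → Set} {xs ys : List A} →
                    xs ⊆ ys → AllPairs R ys → AllPairs R xs
  AllPairs-resp-⊆ []         []       = []
  AllPairs-resp-⊆ (_ ∷ʳ σ)   (_ ∷ rs) = AllPairs-resp-⊆ σ rs
  AllPairs-resp-⊆ (refl ∷ σ) (r ∷ rs) = All-resp-⊆ σ r ∷ AllPairs-resp-⊆ σ rs

  -- A pool of this size lets r more points be added to t chosen ones: the next point is
  -- compared with each of the t chosen points, and every comparison keeps a 1/Q share.
  required : ℕ → ℕ → ℕ → ℕ
  required Q zero    t = 0
  required Q (suc r) t = suc (Q ^ t * required Q r (suc t))

  -- Points are taken from the head of a descending pool, each one ≺-below all earlier ones;
  -- its pair with each earlier point receives a colour from `popular`, and the pool is cut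
  -- down to the points for which all these new colours are good.
  module Greedy {A : Set} (_≺_ : A → A → Set) (C : A → A → Set)
    (good : (x y z : A) → C y z → Bool) (Q : ℕ) .{{_ : NonZero Q}}
    (popular : ∀ {y z} → y ≺ z → (P : List A) → All (_≺ y) P →
               ∃[ c ] length P ≤ Q * length (filterᵇ (λ x → good x y z c) P))
    where

    record Stage (t : ℕ) (pool : List A) : Set where
      field
        chosen     : Fin t → A
        colour     : (a b : Fin t) → a < b → C (chosen a) (chosen b)
        ascending  : (a b : Fin t) → a < b → chosen a ≺ chosen b
        coloured   : (a b c : Fin t) (ab : a < b) (bc : b < c) →
                     T (good (chosen a) (chosen b) (chosen c) (colour b c bc))
        chain      : AllPairs (λ x y → y ≺ x) pool
        below      : All (λ x → ∀ a → x ≺ chosen a) pool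
        compatible : All (λ x → ∀ b c (bc : b < c) → T (good x (chosen b) (chosen c) (colour b c bc))) pool

    record Refinement {t} (y : A) (κ : Fin t → A) (P : List A) : Set where
      field
        colours  : (b : Fin t) → C y (κ b)
        sub      : List A
        sub-⊆    : sub ⊆ P
        sub-good : All (λ x → ∀ b → T (good x y (κ b) (colours b))) sub
        sub-size : length P ≤ Q ^ t * length sub

    refine : ∀ {t} y (κ : Fin t → A) → (∀ b → y ≺ κ b) → ∀ P → All (_≺ y) P → Refinement y κ P
    refine {zero} y κ _ P _ = record
      { colours  = λ ()
      ; sub      = P
      ; sub-⊆    = ⊆-refl
      ; sub-good = All.tabulate (λ _ ())
      ; sub-size = ≤-reflexive (sym (*-identityˡ (length P)))
      }
    refine {suc t} y κ y≺κ P P≺y with popular (y≺κ F.zero) P P≺y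
    ... | c , large = record
      { colours  = λ { F.zero → c ; (F.suc b) → colours b }
      ; sub      = sub
      ; sub-⊆    = ⊆-trans sub-⊆ (filter-⊆ (T? ∘ goodFor) P)
      ; sub-good = All.zipWith (λ (g₀ , gs) → λ { F.zero → g₀ ; (F.suc b) → gs b })
                               (All-resp-⊆ sub-⊆ (all-filter (T? ∘ goodFor) P) , sub-good)
      ; sub-size = begin
          length P                      ≤⟨ large ⟩
          Q * length P₁                 ≤⟨ *-monoʳ-≤ Q sub-size ⟩
          Q * (Q ^ t * length sub)      ≡⟨ sym (*-assoc Q (Q ^ t) (length sub)) ⟩
          Q ^ suc t * length sub        ∎
      }
      where
      goodFor : A → Bool
      goodFor x = good x y (κ F.zero) c
      P₁ = filterᵇ goodFor P
      open Refinement (refine y (κ ∘ F.suc) (y≺κ ∘ F.suc) P₁ (filter⁺ (T? ∘ goodFor) P≺y))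

    extend : ∀ {t y P} → Stage t (y ∷ P) → ∃[ P′ ] Stage (suc t) P′ × length P ≤ Q ^ t * length P′
    extend {t} {y} {P} s with y≺P ∷ P-chain ← Stage.chain s | y≺chosen ∷ P≺chosen ← Stage.below s
                            | y-compatible ∷ P-compatible ← Stage.compatible s =
      sub , stage , sub-size
      where
      open Stage s
      open Refinement (refine y chosen y≺chosen P y≺P)

      chosen′ : Fin (suc t) → A
      chosen′ F.zero    = y
      chosen′ (F.suc a) = chosen a

      colour′ : (a b : Fin (suc t)) → a < b → C (chosen′ a) (chosen′ b)
      colour′ F.zero    (F.suc b) _        = colours b
      colour′ (F.suc a) (F.suc b) (s≤s ab) = colour a b ab

      ascending′ : (a b : Fin (suc t)) → a < b → chosen′ a ≺ chosen′ b
      ascending′ F.zero    (F.suc b) _        = y≺chosen b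
      ascending′ (F.suc a) (F.suc b) (s≤s ab) = ascending a b ab

      coloured′ : (a b c : Fin (suc t)) (ab : a < b) (bc : b < c) →
                  T (good (chosen′ a) (chosen′ b) (chosen′ c) (colour′ b c bc))
      coloured′ F.zero    (F.suc b) (F.suc c) _        (s≤s bc) = y-compatible b c bc
      coloured′ (F.suc a) (F.suc b) (F.suc c) (s≤s ab) (s≤s bc) = coloured a b c ab bc

      stage : Stage (suc t) sub
      stage = record
        { chosen     = chosen′
        ; colour     = colour′
        ; ascending  = ascending′
        ; coloured   = coloured′
        ; chain      = AllPairs-resp-⊆ sub-⊆ P-chain
        ; below      = All.zipWith (λ (x≺y , x≺chosen) → λ { F.zero → x≺y ; (F.suc a) → x≺chosen a })
                                   (All-resp-⊆ sub-⊆ y≺P , All-resp-⊆ sub-⊆ P≺chosen)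
        ; compatible = All.zipWith
            (λ (new , old) → λ { F.zero (F.suc c) _ → new c ; (F.suc b) (F.suc c) (s≤s bc) → old b c bc })
            (sub-good , All-resp-⊆ sub-⊆ P-compatible)
        }

    build : ∀ r {t P} → Stage t P → required Q r t ≤ length P → ∃[ P′ ] Stage (t + r) P′
    build zero    {t}         s _ = _ , subst (λ u → Stage u _) (sym (+-identityʳ t)) s
    build (suc r) {t} {y ∷ P} s (s≤s enough) with extend s
    ... | P′ , s′ , shrink =
      map₂ (λ {P″} → subst (λ u → Stage u P″) (sym (+-suc t r)))
           (build r s′ (*-cancelˡ-≤ (Q ^ t) {{m^n≢0 Q t}} (≤-trans enough shrink)))

    initial : ∀ {P} → AllPairs (λ x y → y ≺ x) P → Stage 0 P
    initial chain = record
      { chosen     = λ ()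
      ; colour     = λ ()
      ; ascending  = λ ()
      ; coloured   = λ ()
      ; chain      = chain
      ; below      = All.tabulate (λ _ ())
      ; compatible = All.tabulate (λ _ ())
      }

    greedy : ∀ r {P} → AllPairs (λ x y → y ≺ x) P → required Q r 0 ≤ length P → ∃[ P′ ] Stage r P′
    greedy r chain = build r (initial chain)

  opposite-reverses-< : ∀ {n} {a b : Fin n} → a < b → opposite b < opposite a
  opposite-reverses-< {n} {a} {b} a<b rewrite Fin.opposite-prop a | Fin.opposite-prop b =
    ∸-monoʳ-< (s≤s a<b) (Fin.toℕ<n b)

  -- γ and the chosen colours only exist above the diagonal; the default fills the other
  -- pairs so that the goodness tests are Boolean functions of the points alone.
  withDefault : ∀ {n} {D : Fin n → Fin n → Set} →
                (∀ i k → D i k) → ((i k : Fin n) → i < k → D i k) → (i k : Fin n) → D i k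
  withDefault d f i k with i Fin.<? k
  ... | yes i<k = f i k i<k
  ... | no  _   = d i k

  withDefault-< : ∀ {n} {D : Fin n → Fin n → Set}
                  (d : ∀ i k → D i k) (f : (i k : Fin n) → i < k → D i k) {i k : Fin n} (i<k : i < k) →
                  withDefault d f i k ≡ f i k i<k
  withDefault-< d f {i} {k} i<k with i Fin.<? k
  ... | yes i<k′ = cong (f i k) (Fin.<-irrelevant i<k′ i<k)
  ... | no  i≮k  = contradiction i<k i≮k

  Transversal : ∀ {N} (H : PartHyp N) → ((i k : Fin N) → i < k → PartHyp.V H i k) → ℕ → Set
  Transversal {N} H γ n = let open PartHyp H in
    Σ (Fin n → Fin N) λ ι →
    Σ ((a b : Fin n) → a < b → ι a < ι b) λ mono →
    Σ ((a b : Fin n) → a < b → V (ι a) (ι b)) λ α →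
    Σ ((a b : Fin n) → a < b → V (ι a) (ι b)) λ β →
      ((a b c : Fin n) → (ab : a < b) → (bc : b < c) → (ac : a < c) →
        edge (ι a) (ι b) (ι c) (α a b ab) (γ (ι a) (ι c) (mono a c ac)) (β b c bc) ≡ true)

  module Construction {N} (H : PartHyp N) (q : ℕ) .{{_ : NonZero q}}
    (γ : (i k : Fin N) → i < k → PartHyp.V H i k)
    (dense : ∀ {i j k} → i < j → j < k → (i<k : i < k) →
             suc (PartHyp.size H i j) * suc (PartHyp.size H j k) ≤ q * PartHyp.edgeCount H i j k (γ i k i<k))
    where

    open PartHyp H

    γ̂ : (i k : Fin N) → V i k
    γ̂ = withDefault (λ _ _ → F.zero) γ

    γ̂-< : ∀ {i k} (i<k : i < k) → γ̂ i k ≡ γ i k i<k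
    γ̂-< = withDefault-< (λ _ _ → F.zero) γ

    partners : (i j k : Fin N) → V j k → ℕ
    partners i j k b = countFin (suc (size i j)) (λ a → edge i j k a (γ̂ i k) b)

    partners-≤ : ∀ i j k b → partners i j k b ≤ suc (size i j)
    partners-≤ i j k b = countFin-≤ (suc (size i j)) (λ a → edge i j k a (γ̂ i k) b)

    edgeCount-≡-sum-partners : ∀ i j k → edgeCount i j k (γ̂ i k) ≡ sumFin (suc (size j k)) (partners i j k)
    edgeCount-≡-sum-partners i j k =
      sumFin-comm (suc (size i j)) (suc (size j k)) (λ a b → indicator (edge i j k a (γ̂ i k) b))

    popularFor : (i j k : Fin N) → V j k → Bool
    popularFor i j k b = suc (size i j) ≤ᵇ 2 * q * partners i j k b

    popular-β : ∀ {j k} → j < k → (P : List (Fin N)) → All (_< j) P →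
                ∃[ b ] length P ≤ 2 * q * length (filterᵇ (λ i → popularFor i j k b) P)
    popular-β {j} {k} j<k P P<j =
      dense-column (2 * q) (size j k) (λ i → popularFor i j k) P (All.map row P<j)
      where
      row : ∀ {i} → i < j → suc (size j k) ≤ 2 * q * countFin (suc (size j k)) (popularFor i j k)
      row {i} i<j = reverse-Markov q (size j k) (size i j) (partners i j k) (partners-≤ i j k) (begin
        suc (size i j) * suc (size j k)               ≤⟨ dense i<j j<k i<k ⟩
        q * edgeCount i j k (γ i k i<k)               ≡⟨ cong (λ c → q * edgeCount i j k c) (sym (γ̂-< i<k)) ⟩
        q * edgeCount i j k (γ̂ i k)                   ≡⟨ cong (q *_) (edgeCount-≡-sum-partners i j k) ⟩
        q * sumFin (suc (size j k)) (partners i j k)  ∎)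
        where i<k = Fin.<-trans i<j j<k

    module Greedy₁ = Greedy _<_ V popularFor (2 * q) {{m*n≢0 2 q}} popular-β

    phase₁ : ∀ m → required (2 * q) m 0 ≤ N → ∃[ P ] Greedy₁.Stage m P
    phase₁ m enough = Greedy₁.greedy m (tabulate⁺-< {f = opposite} opposite-reverses-<)
                                    (≤-trans enough (≤-reflexive (sym (length-tabulate opposite))))

    -- The second pass runs on the phase-1 positions in decreasing order, so the colour chosen
    -- for a pair z < y is α_zy, and it must complete the triangle z < y < x for later x.
    module Phase₂ {m P₁} (s₁ : Greedy₁.Stage m P₁) where
      open Greedy₁.Stage s₁ using ()
        renaming (chosen to ι₁; colour to β₁; ascending to ι₁-ascending; coloured to β₁-popular)

      β̂₁ : (a b : Fin m) → V (ι₁ a) (ι₁ b)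
      β̂₁ = withDefault (λ _ _ → F.zero) β₁

      β̂₁-< : ∀ {a b} (a<b : a < b) → β̂₁ a b ≡ β₁ a b a<b
      β̂₁-< = withDefault-< (λ _ _ → F.zero) β₁

      completes : (x y z : Fin m) → V (ι₁ z) (ι₁ y) → Bool
      completes x y z a = edge (ι₁ z) (ι₁ y) (ι₁ x) a (γ̂ (ι₁ z) (ι₁ x)) (β̂₁ y x)

      popular-α : ∀ {y z} → z < y → (P : List (Fin m)) → All (y <_) P →
                  ∃[ a ] length P ≤ 2 * q * length (filterᵇ (λ x → completes x y z a) P)
      popular-α {y} {z} z<y P y<P =
        dense-column (2 * q) (size (ι₁ z) (ι₁ y)) (λ x → completes x y z) P (All.map row y<P)
        where
        row : ∀ {x} → y < x →
              suc (size (ι₁ z) (ι₁ y)) ≤ 2 * q * countFin (suc (size (ι₁ z) (ι₁ y))) (completes x y z)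
        row {x} y<x = subst (λ b → suc (size (ι₁ z) (ι₁ y)) ≤ 2 * q * partners (ι₁ z) (ι₁ y) (ι₁ x) b)
                            (sym (β̂₁-< y<x))
                            (≤ᵇ⇒≤ _ _ (β₁-popular z y x z<y y<x))

      module Greedy₂ =
        Greedy (λ a b → b < a) (λ y z → V (ι₁ z) (ι₁ y)) completes (2 * q) {{m*n≢0 2 q}} popular-α

      phase₂ : ∀ n → required (2 * q) n 0 ≤ m → ∃[ P ] Greedy₂.Stage n P
      phase₂ n enough = Greedy₂.greedy n (tabulate⁺-< {f = id} id)
                                      (≤-trans enough (≤-reflexive (sym (length-tabulate id))))

      transversal : ∀ {n P₂} → Greedy₂.Stage n P₂ → Transversal H γ n
      transversal {n} s₂ = ι , ι-ascending , α , β , is-edge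
        where
        open Greedy₂.Stage s₂ using ()
          renaming (chosen to ι₂; colour to α₂; ascending to ι₂-descending; coloured to α₂-completes)

        ρ : Fin n → Fin m
        ρ a = ι₂ (opposite a)

        ρ-ascending : ∀ {a b} → a < b → ρ a < ρ b
        ρ-ascending a<b = ι₂-descending _ _ (opposite-reverses-< a<b)

        ι : Fin n → Fin N
        ι a = ι₁ (ρ a)

        ι-ascending : (a b : Fin n) → a < b → ι a < ι b
        ι-ascending a b a<b = ι₁-ascending _ _ (ρ-ascending a<b)

        α β : (a b : Fin n) → a < b → V (ι a) (ι b)
        α a b a<b = α₂ (opposite b) (opposite a) (opposite-reverses-< a<b)
        β a b a<b = β₁ (ρ a) (ρ b) (ρ-ascending a<b)

        is-edge : (a b c : Fin n) (ab : a < b) (bc : b < c) (ac : a < c) →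
                  edge (ι a) (ι b) (ι c) (α a b ab) (γ (ι a) (ι c) (ι-ascending a c ac)) (β b c bc) ≡ true
        is-edge a b c ab bc ac = Equivalence.to T-≡
          (subst₂ (λ g b′ → T (edge (ι a) (ι b) (ι c) (α a b ab) g b′))
                  (γ̂-< (ι-ascending a c ac))
                  (β̂₁-< (ρ-ascending bc))
                  (α₂-completes (opposite c) (opposite b) (opposite a)
                                (opposite-reverses-< bc) (opposite-reverses-< ab)))

  transversal-exists : ∀ q .{{_ : NonZero q}} n → Σ ℕ λ N → (H : PartHyp N) →
    (γ : (i k : Fin N) → i < k → PartHyp.V H i k) →
    (∀ {i j k} → i < j → j < k → (i<k : i < k) →
       suc (PartHyp.size H i j) * suc (PartHyp.size H j k) ≤ q * PartHyp.edgeCount H i j k (γ i k i<k)) →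
    Transversal H γ n
  transversal-exists q n = required (2 * q) m 0 , λ H γ dense →
    let open Construction H q γ dense
        _ , s₁ = phase₁ m ≤-refl
        _ , s₂ = Phase₂.phase₂ s₁ n ≤-refl
    in Phase₂.transversal s₁ s₂
    where m = required (2 * q) n 0

open import Data.Bool using (true)
open import Data.Fin using (Fin; _<_)
open import Data.Integer as ℤ using (+[1+_]; -[1+_])
import Data.Integer.Properties as ℤ
open import Data.Nat as ℕ using (ℕ; zero; suc; _*_)
import Data.Nat.Properties as ℕ
open import Data.Product using (Σ; map₂)
open import Data.Rational as ℚ using (ℚ; mkℚ; 0ℚ; _/_; _≤_; _>_)
import Data.Rational.Properties as ℚ
import Data.Rational.Unnormalised as ℚᵘ
import Data.Rational.Unnormalised.Properties as ℚᵘ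
open import Relation.Binary.PropositionalEquality using (_≡_; sym; subst₂)
open TriadTransversals using (transversal-exists)

≤-/⇒≤-denominator-* : ∀ {δ e w} .{{_ : ℕ.NonZero w}} → 0ℚ ℚ.< δ → δ ≤ ℤ.+ e / w → w ℕ.≤ ℚ.↧ₙ δ * e
-- Cross-multiplying δ = (1+p)/(1+d) ≤ e/w gives (1+p)·w ≤ e·(1+d).
≤-/⇒≤-denominator-* {mkℚ +[1+ p ] d _} {e} {suc w} _ δ≤e/w
  with ℚᵘ.*≤* [1+p]w≤ed ← ℚᵘ.≤-respʳ-≃ (ℚ.toℚᵘ-fromℚᵘ (ℚᵘ.mkℚᵘ (ℤ.+ e) w)) (ℚ.toℚᵘ-mono-≤ δ≤e/w)
  = ℕ.≤-trans (ℕ.m≤m+n (suc w) (p * suc w)) (ℕ.≤-trans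
      (ℤ.drop‿+≤+ (subst₂ ℤ._≤_ (sym (ℤ.pos-* (suc p) (suc w))) (sym (ℤ.pos-* e (suc d))) [1+p]w≤ed))
      (ℕ.≤-reflexive (ℕ.*-comm e (suc d))))
≤-/⇒≤-denominator-* {mkℚ (ℤ.+ zero) _ _} (ℚ.*<* (ℤ.+<+ ()))
≤-/⇒≤-denominator-* {mkℚ -[1+ _ ] _ _} (ℚ.*<* ())

lemma12 : (δ : ℚ) → δ > 0ℚ → (n : ℕ) →
    Σ ℕ λ N → (H : PartHyp N) →
      let open PartHyp H in
      (γ : (i k : Fin N) → i < k → V i k) →
      ((i j k : Fin N) → (ij : i < j) → (jk : j < k) → (ik : i < k) →
        δ ≤ degree i j k (γ i k ik)) →
      Σ (Fin n → Fin N) λ ι →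
        Σ ((a b : Fin n) → a < b → ι a < ι b) λ mono →
        Σ ((a b : Fin n) → a < b → V (ι a) (ι b)) λ α →
        Σ ((a b : Fin n) → a < b → V (ι a) (ι b)) λ β →
          ((a b c : Fin n) → (ab : a < b) → (bc : b < c) → (ac : a < c) →
            edge (ι a) (ι b) (ι c) (α a b ab) (γ (ι a) (ι c) (mono a c ac)) (β b c bc) ≡ true)
lemma12 δ δ>0 n = map₂ (λ construct H γ hyp → construct H γ λ {i} {j} {k} i<j j<k i<k →
    ≤-/⇒≤-denominator-* δ>0 (hyp i j k i<j j<k i<k))
  (transversal-exists (ℚ.↧ₙ δ) n)
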